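{- Let $n\ge1$ and let $\mathcal{T}_n$ be the set of plane trees with $n$ edges. (1) The number of trees in $\mathcal{T}_n$ with exactly one old leaf is $2^{n-1}$. (2) The number of trees in $\mathcal{T}_n$ with no young leaves is the Motzkin number $M_{n-1}$.
   Context: A plane (ordered) tree is a rooted tree in which the children of each vertex are linearly ordered (from left to right). A leaf is a vertex with no children. A leaf is an old leaf if it is the leftmost child of its parent, and a young leaf otherwise. $M_m$ denotes the $m$-th Motzkin number, the number of lattice paths from $(0,0)$ to $(m,0)$ with steps $(1,1),(1,-1),(1,0)$ that never go below the $x$-axis. -}

module Defs where

open import Data.Nat using (ℕ; zero; suc; _+_)
open import Data.List using (List; []; _∷_; length; sum; map; concatMap; filter)
open import Data.Bool using (Bool; true; false; _∧_)

-- Plane (ordered) trees: a vertex with an ordered list of subtrees (left to right).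
data PTree : Set where
  node : List PTree → PTree

mutual
  edges : PTree → ℕ
  edges (node ts) = edgesF ts

  edgesF : List PTree → ℕ
  edgesF [] = zero
  edgesF (t ∷ ts) = suc (edges t) + edgesF ts

isLeaf : PTree → Bool
isLeaf (node []) = true
isLeaf (node (_ ∷ _)) = false

b2n : Bool → ℕ
b2n true = 1
b2n false = 0

-- old leaves: leaves that are the leftmost child of their parent
mutual
  oldLeaves : PTree → ℕ
  oldLeaves (node []) = zero
  oldLeaves (node (t ∷ ts)) = b2n (isLeaf t) + (oldLeaves t + oldLeavesF ts)

  oldLeavesF : List PTree → ℕ
  oldLeavesF [] = zero
  oldLeavesF (t ∷ ts) = oldLeaves t + oldLeavesF ts

-- young leaves: leaves that are a child but not the leftmost child of their parent
mutual
  youngLeaves : PTree → ℕ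
  youngLeaves (node []) = zero
  youngLeaves (node (t ∷ ts)) = youngLeaves t + youngLeavesF ts

  youngLeavesF : List PTree → ℕ
  youngLeavesF [] = zero
  youngLeavesF (t ∷ ts) = b2n (isLeaf t) + (youngLeaves t + youngLeavesF ts)

-- Motzkin paths: sequences of steps U=(1,1), D=(1,-1), F=(1,0)
data Step : Set where
  U D F : Step

allSeqs : ℕ → List (List Step)
allSeqs zero = [] ∷ []
allSeqs (suc m) = concatMap (λ s → map (s ∷_) (allSeqs m)) (U ∷ D ∷ F ∷ [])

validFrom : ℕ → List Step → Bool
validFrom zero [] = true
validFrom (suc _) [] = false
validFrom h (U ∷ s) = validFrom (suc h) s
validFrom zero (D ∷ s) = false
validFrom (suc h) (D ∷ s) = validFrom h s
validFrom h (F ∷ s) = validFrom h s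

isMotzkinPath : List Step → Bool
isMotzkinPath = validFrom zero

countTrue : {A : Set} → (A → Bool) → List A → ℕ
countTrue p [] = zero
countTrue p (x ∷ xs) = b2n (p x) + countTrue p xs

Motzkin : ℕ → ℕ
Motzkin m = countTrue isMotzkinPath (allSeqs m)

-- In a tree with exactly one old leaf every child that is not leftmost is a
-- leaf, since a non-leaf subtree contains an old leaf of its own. So either the
-- second child of the root is a leaf, which can be deleted, or the root has a
-- single child and can be deleted: trees with m + 2 edges are two copies of
-- those with m + 1 edges.
--
-- A tree without young leaves is encoded as a Motzkin path by recursively
-- cutting off the second child of the root, or the root itself when it has a
-- single child. Decoding reads the path from right to left, keeping one tree
-- for each level of height.
module Submission where

open import Defs
open import Data.Nat using (ℕ; zero; suc; _+_; _^_; _≤_; z≤n; s≤s)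
open import Data.Nat.Properties
  using (+-identityʳ; +-suc; +-assoc; suc-injective; m+n≡0⇒m≡0; m+n≡0⇒n≡0; +-mono-≤; m≤m+n; ≤-trans; module ≤-Reasoning)
  renaming (≡-irrelevant to ℕ-≡-irrelevant)
open import Data.Nat.Tactic.RingSolver using (solve-∀)
open import Data.Bool using (Bool; true; false)
import Data.Bool as Bool
open import Data.Fin using (Fin; zero)
open import Data.Fin.Properties using (+↔⊎)
open import Data.Product using (Σ; _×_; _,_; proj₁; proj₂)
open import Data.Sum using (_⊎_; inj₁; inj₂)
open import Data.Sum.Function.Propositional using (_⊎-↔_)
open import Data.List using (List; []; _∷_; _++_; length; map; foldr)
open import Data.List.Properties using (++-identityʳ; ++-assoc; length-++)
open import Data.List.Relation.Unary.All using (All; []; _∷_)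
open import Data.Empty using (⊥-elim)
open import Function using (_∘_)
open import Function.Bundles using (_↔_; mk↔ₛ′)
open import Function.Related.Propositional using (module EquationalReasoning)
open import Function.Properties.Inverse using (↔-refl; ↔-trans)
open import Relation.Binary.PropositionalEquality
  using (_≡_; _≢_; refl; subst; sym; trans; cong; cong₂; module ≡-Reasoning)
open import Axiom.UniquenessOfIdentityProofs using (module Decidable⇒UIP)

Bool-≡-irrelevant : {a b : Bool} (p q : a ≡ b) → p ≡ q
Bool-≡-irrelevant = Decidable⇒UIP.≡-irrelevant Bool._≟_

Trees : ℕ → (PTree → ℕ) → ℕ → Set
Trees n stat k = Σ PTree (λ t → (edges t ≡ n) × (stat t ≡ k))

Paths : (List Step → Bool) → ℕ → Set
Paths p m = Σ (List Step) (λ s → (length s ≡ m) × (p s ≡ true))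

Trees-≡ : ∀ {n k stat} {x y : Trees n stat k} → proj₁ x ≡ proj₁ y → x ≡ y
Trees-≡ {x = t , e , o} {y = .t , e′ , o′} refl =
  cong₂ (λ e o → t , e , o) (ℕ-≡-irrelevant e e′) (ℕ-≡-irrelevant o o′)

Paths-≡ : ∀ {p m} {x y : Paths p m} → proj₁ x ≡ proj₁ y → x ≡ y
Paths-≡ {x = s , l , v} {y = .s , l′ , v′} refl =
  cong₂ (λ l v → s , l , v) (ℕ-≡-irrelevant l l′) (Bool-≡-irrelevant v v′)

stick : PTree
stick = node (node [] ∷ [])

-- Trees with exactly one old leaf

firstChild-oldLeaf : ∀ t → 1 ≤ b2n (isLeaf t) + oldLeaves t
firstChild-oldLeaf (node []) = s≤s z≤n
firstChild-oldLeaf (node (u ∷ us)) = ≤-trans (firstChild-oldLeaf u) (begin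
  b2n (isLeaf u) + oldLeaves u                     ≤⟨ m≤m+n _ (oldLeavesF us) ⟩
  b2n (isLeaf u) + oldLeaves u + oldLeavesF us     ≡⟨ +-assoc (b2n (isLeaf u)) _ _ ⟩
  b2n (isLeaf u) + (oldLeaves u + oldLeavesF us)   ∎)
  where open ≤-Reasoning

2≤oldLeaves-secondBranch : ∀ t u us ts → 2 ≤ oldLeaves (node (t ∷ node (u ∷ us) ∷ ts))
2≤oldLeaves-secondBranch t u us ts = begin
  1 + 1                                                      ≤⟨ +-mono-≤ (firstChild-oldLeaf t) secondBranch ⟩
  (b2n (isLeaf t) + oldLeaves t) + (oldLeaves b + oldLeavesF ts) ≡⟨ +-assoc (b2n (isLeaf t)) _ _ ⟩
  oldLeaves (node (t ∷ b ∷ ts))                              ∎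
  where
  open ≤-Reasoning
  b = node (u ∷ us)
  secondBranch : 1 ≤ oldLeaves b + oldLeavesF ts
  secondBranch = ≤-trans (firstChild-oldLeaf b) (m≤m+n _ (oldLeavesF ts))

secondBranch-oldLeaves≢1 : ∀ t u us ts → oldLeaves (node (t ∷ node (u ∷ us) ∷ ts)) ≢ 1
secondBranch-oldLeaves≢1 t u us ts eq with subst (2 ≤_) eq (2≤oldLeaves-secondBranch t u us ts)
... | s≤s ()

module _ {m : ℕ} where
  grow : Trees (suc m) oldLeaves 1 ⊎ Trees (suc m) oldLeaves 1 → Trees (suc (suc m)) oldLeaves 1
  grow (inj₁ (node [] , () , _))
  grow (inj₁ (node (t ∷ ts) , e , o)) =
    node (t ∷ node [] ∷ ts) , cong suc (trans (+-suc (edges t) (edgesF ts)) e) , o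
  grow (inj₂ (node [] , () , _))
  grow (inj₂ (node (u ∷ us) , e , o)) =
    node (node (u ∷ us) ∷ []) , cong suc (trans (+-identityʳ _) e) , trans (+-identityʳ _) o

  prune : Trees (suc (suc m)) oldLeaves 1 → Trees (suc m) oldLeaves 1 ⊎ Trees (suc m) oldLeaves 1
  prune (node [] , () , _)
  prune (node (node [] ∷ []) , () , _)
  prune (node (node (u ∷ us) ∷ []) , e , o) =
    inj₂ (node (u ∷ us) , trans (sym (+-identityʳ _)) (suc-injective e) , trans (sym (+-identityʳ _)) o)
  prune (node (t ∷ node [] ∷ ts) , e , o) =
    inj₁ (node (t ∷ ts) , trans (sym (+-suc (edges t) (edgesF ts))) (suc-injective e) , o)
  prune (node (t ∷ node (u ∷ us) ∷ ts) , _ , o) = ⊥-elim (secondBranch-oldLeaves≢1 t u us ts o)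

  grow-prune : ∀ x → grow (prune x) ≡ x
  grow-prune (node [] , () , _)
  grow-prune (node (node [] ∷ []) , () , _)
  grow-prune (node (node (u ∷ us) ∷ []) , e , o) = Trees-≡ refl
  grow-prune (node (node [] ∷ node [] ∷ ts) , e , o) = Trees-≡ refl
  grow-prune (node (node (_ ∷ _) ∷ node [] ∷ ts) , e , o) = Trees-≡ refl
  grow-prune (node (t ∷ node (u ∷ us) ∷ ts) , _ , o) = ⊥-elim (secondBranch-oldLeaves≢1 t u us ts o)

  prune-grow : ∀ x → prune (grow x) ≡ x
  prune-grow (inj₁ (node [] , () , _))
  prune-grow (inj₁ (node (node [] ∷ ts) , e , o)) = cong inj₁ (Trees-≡ refl)
  prune-grow (inj₁ (node (node (_ ∷ _) ∷ ts) , e , o)) = cong inj₁ (Trees-≡ refl)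
  prune-grow (inj₂ (node [] , () , _))
  prune-grow (inj₂ (node (u ∷ us) , e , o)) = cong inj₂ (Trees-≡ refl)

  grow-↔ : (Trees (suc m) oldLeaves 1 ⊎ Trees (suc m) oldLeaves 1) ↔ Trees (suc (suc m)) oldLeaves 1
  grow-↔ = mk↔ₛ′ grow prune grow-prune prune-grow

stick-oneOld : ∀ {x : Trees 1 oldLeaves 1} → (stick , refl , refl) ≡ x
stick-oneOld {node [] , () , _}
stick-oneOld {node (node [] ∷ []) , _ , _} = Trees-≡ refl
stick-oneOld {node (node (_ ∷ _) ∷ _) , () , _}
stick-oneOld {node (node [] ∷ _ ∷ _) , () , _}

oneOld↔ : ∀ m → Fin (2 ^ m) ↔ Trees (suc m) oldLeaves 1
oneOld↔ zero = mk↔ₛ′ (λ _ → stick , refl , refl) (λ _ → zero) (λ _ → stick-oneOld) λ { zero → refl }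
oneOld↔ (suc m) = begin
  Fin (2 ^ suc m)                                     ≡⟨ cong (Fin ∘ (2 ^ m +_)) (+-identityʳ (2 ^ m)) ⟩
  Fin (2 ^ m + 2 ^ m)                                 ↔⟨ +↔⊎ ⟩
  (Fin (2 ^ m) ⊎ Fin (2 ^ m))                         ↔⟨ oneOld↔ m ⊎-↔ oneOld↔ m ⟩
  (Trees (suc m) oldLeaves 1 ⊎ Trees (suc m) oldLeaves 1) ↔⟨ grow-↔ ⟩
  Trees (suc (suc m)) oldLeaves 1                     ∎
  where open EquationalReasoning

countTrue-++ : ∀ {A : Set} (p : A → Bool) xs ys → countTrue p (xs ++ ys) ≡ countTrue p xs + countTrue p ys
countTrue-++ p [] ys = refl
countTrue-++ p (x ∷ xs) ys = trans (cong (b2n (p x) +_) (countTrue-++ p xs ys)) (sym (+-assoc (b2n (p x)) _ _))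

countTrue-map : ∀ {A B : Set} (p : B → Bool) (f : A → B) xs → countTrue p (map f xs) ≡ countTrue (p ∘ f) xs
countTrue-map p f [] = refl
countTrue-map p f (x ∷ xs) = cong (b2n (p (f x)) +_) (countTrue-map p f xs)

countTrue-allSeqs-suc : ∀ m p → countTrue p (allSeqs (suc m)) ≡
  countTrue (p ∘ (U ∷_)) (allSeqs m) + (countTrue (p ∘ (D ∷_)) (allSeqs m) + countTrue (p ∘ (F ∷_)) (allSeqs m))
countTrue-allSeqs-suc m p = begin
  countTrue p (map (U ∷_) A ++ map (D ∷_) A ++ map (F ∷_) A ++ [])
    ≡⟨ countTrue-++ p (map (U ∷_) A) _ ⟩
  countTrue p (map (U ∷_) A) + countTrue p (map (D ∷_) A ++ map (F ∷_) A ++ [])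
    ≡⟨ cong (countTrue p (map (U ∷_) A) +_) (countTrue-++ p (map (D ∷_) A) _) ⟩
  countTrue p (map (U ∷_) A) + (countTrue p (map (D ∷_) A) + countTrue p (map (F ∷_) A ++ []))
    ≡⟨ cong₂ (λ x y → x + (countTrue p (map (D ∷_) A) + y))
             (countTrue-map p (U ∷_) A) (cong (countTrue p) (++-identityʳ (map (F ∷_) A))) ⟩
  countTrue (p ∘ (U ∷_)) A + (countTrue p (map (D ∷_) A) + countTrue p (map (F ∷_) A))
    ≡⟨ cong₂ (λ x y → countTrue (p ∘ (U ∷_)) A + (x + y)) (countTrue-map p (D ∷_) A) (countTrue-map p (F ∷_) A) ⟩
  countTrue (p ∘ (U ∷_)) A + (countTrue (p ∘ (D ∷_)) A + countTrue (p ∘ (F ∷_)) A) ∎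
  where
  open ≡-Reasoning
  A = allSeqs m

Fin-b2n↔ : ∀ b → Fin (b2n b) ↔ (b ≡ true)
Fin-b2n↔ true = mk↔ₛ′ (λ _ → refl) (λ _ → zero) (λ { refl → refl }) λ { zero → refl }
Fin-b2n↔ false = mk↔ₛ′ (λ ()) (λ ()) (λ ()) (λ ())

Paths-zero↔ : ∀ p → (p [] ≡ true) ↔ Paths p 0
Paths-zero↔ p = mk↔ₛ′ (λ v → [] , refl , v) from (λ { ([] , refl , v) → refl }) (λ _ → refl)
  where
  from : Paths p 0 → p [] ≡ true
  from ([] , _ , v) = v

Paths-suc↔ : ∀ m p → (Paths (p ∘ (U ∷_)) m ⊎ (Paths (p ∘ (D ∷_)) m ⊎ Paths (p ∘ (F ∷_)) m)) ↔ Paths p (suc m)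
Paths-suc↔ m p = mk↔ₛ′ cons uncons cons-uncons uncons-cons
  where
  cons : Paths (p ∘ (U ∷_)) m ⊎ (Paths (p ∘ (D ∷_)) m ⊎ Paths (p ∘ (F ∷_)) m) → Paths p (suc m)
  cons (inj₁ (s , l , v)) = U ∷ s , cong suc l , v
  cons (inj₂ (inj₁ (s , l , v))) = D ∷ s , cong suc l , v
  cons (inj₂ (inj₂ (s , l , v))) = F ∷ s , cong suc l , v

  uncons : Paths p (suc m) → Paths (p ∘ (U ∷_)) m ⊎ (Paths (p ∘ (D ∷_)) m ⊎ Paths (p ∘ (F ∷_)) m)
  uncons (U ∷ s , l , v) = inj₁ (s , suc-injective l , v)
  uncons (D ∷ s , l , v) = inj₂ (inj₁ (s , suc-injective l , v))
  uncons (F ∷ s , l , v) = inj₂ (inj₂ (s , suc-injective l , v))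

  cons-uncons : ∀ x → cons (uncons x) ≡ x
  cons-uncons (U ∷ s , l , v) = Paths-≡ refl
  cons-uncons (D ∷ s , l , v) = Paths-≡ refl
  cons-uncons (F ∷ s , l , v) = Paths-≡ refl

  uncons-cons : ∀ x → uncons (cons x) ≡ x
  uncons-cons (inj₁ _) = cong inj₁ (Paths-≡ refl)
  uncons-cons (inj₂ (inj₁ _)) = cong (inj₂ ∘ inj₁) (Paths-≡ refl)
  uncons-cons (inj₂ (inj₂ _)) = cong (inj₂ ∘ inj₂) (Paths-≡ refl)

countTrue-allSeqs↔ : ∀ m p → Fin (countTrue p (allSeqs m)) ↔ Paths p m
countTrue-allSeqs↔ zero p = begin
  Fin (b2n (p []) + 0) ≡⟨ cong Fin (+-identityʳ _) ⟩
  Fin (b2n (p []))     ↔⟨ Fin-b2n↔ (p []) ⟩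
  (p [] ≡ true)        ↔⟨ Paths-zero↔ p ⟩
  Paths p 0            ∎
  where open EquationalReasoning
countTrue-allSeqs↔ (suc m) p = begin
  Fin (countTrue p (allSeqs (suc m)))
    ≡⟨ cong Fin (countTrue-allSeqs-suc m p) ⟩
  Fin (countTrue (p ∘ (U ∷_)) A + (countTrue (p ∘ (D ∷_)) A + countTrue (p ∘ (F ∷_)) A))
    ↔⟨ +↔⊎ ⟩
  (Fin (countTrue (p ∘ (U ∷_)) A) ⊎ Fin (countTrue (p ∘ (D ∷_)) A + countTrue (p ∘ (F ∷_)) A))
    ↔⟨ ↔-refl ⊎-↔ +↔⊎ ⟩
  (Fin (countTrue (p ∘ (U ∷_)) A) ⊎ (Fin (countTrue (p ∘ (D ∷_)) A) ⊎ Fin (countTrue (p ∘ (F ∷_)) A)))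
    ↔⟨ countTrue-allSeqs↔ m _ ⊎-↔ (countTrue-allSeqs↔ m _ ⊎-↔ countTrue-allSeqs↔ m _) ⟩
  (Paths (p ∘ (U ∷_)) m ⊎ (Paths (p ∘ (D ∷_)) m ⊎ Paths (p ∘ (F ∷_)) m))
    ↔⟨ Paths-suc↔ m p ⟩
  Paths p (suc m) ∎
  where
  open EquationalReasoning
  A = allSeqs m

-- Trees without young leaves

mutual
  data NoYoung : PTree → Set where
    node : ∀ {c cs} → FirstChild c → All NoYoung cs → NoYoung (node (c ∷ cs))

  data FirstChild : PTree → Set where
    leaf : FirstChild (node [])
    tree : ∀ {t} → NoYoung t → FirstChild t

mutual
  youngLeaves≡0⇒NoYoung : ∀ c cs → youngLeaves (node (c ∷ cs)) ≡ 0 → NoYoung (node (c ∷ cs))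
  youngLeaves≡0⇒NoYoung c cs y =
    node (youngLeaves≡0⇒FirstChild c (m+n≡0⇒m≡0 _ y)) (youngLeavesF≡0⇒All cs (m+n≡0⇒n≡0 _ y))

  youngLeaves≡0⇒FirstChild : ∀ t → youngLeaves t ≡ 0 → FirstChild t
  youngLeaves≡0⇒FirstChild (node []) _ = leaf
  youngLeaves≡0⇒FirstChild (node (c ∷ cs)) y = tree (youngLeaves≡0⇒NoYoung c cs y)

  youngLeavesF≡0⇒All : ∀ ts → youngLeavesF ts ≡ 0 → All NoYoung ts
  youngLeavesF≡0⇒All [] _ = []
  youngLeavesF≡0⇒All (node (c ∷ cs) ∷ ts) y =
    youngLeaves≡0⇒NoYoung c cs (m+n≡0⇒m≡0 _ y) ∷ youngLeavesF≡0⇒All ts (m+n≡0⇒n≡0 _ y)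

mutual
  NoYoung⇒youngLeaves≡0 : ∀ {t} → NoYoung t → youngLeaves t ≡ 0
  NoYoung⇒youngLeaves≡0 (node f ns) = cong₂ _+_ (FirstChild⇒youngLeaves≡0 f) (All⇒youngLeavesF≡0 ns)

  FirstChild⇒youngLeaves≡0 : ∀ {t} → FirstChild t → youngLeaves t ≡ 0
  FirstChild⇒youngLeaves≡0 leaf = refl
  FirstChild⇒youngLeaves≡0 (tree n) = NoYoung⇒youngLeaves≡0 n

  All⇒youngLeavesF≡0 : ∀ {ts} → All NoYoung ts → youngLeavesF ts ≡ 0
  All⇒youngLeavesF≡0 [] = refl
  All⇒youngLeavesF≡0 (n@(node _ _) ∷ ns) = cong₂ _+_ (NoYoung⇒youngLeaves≡0 n) (All⇒youngLeavesF≡0 ns)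

mutual
  encode : PTree → List Step
  encode (node []) = []
  encode (node (c ∷ cs)) = encodeChildren c cs

  encodeChildren : PTree → List PTree → List Step
  encodeChildren c (d ∷ cs) = U ∷ (encodeChildren c cs ++ D ∷ encode d)
  encodeChildren (node []) [] = []
  encodeChildren (node (x ∷ xs)) [] = F ∷ encodeChildren x xs

length-encode : ∀ {t} → NoYoung t → suc (length (encode t)) ≡ edges t
length-encode (node leaf []) = refl
length-encode (node (tree n@(node _ _)) []) = cong suc (trans (length-encode n) (sym (+-identityʳ _)))
length-encode (node {c} {d ∷ cs} f (n ∷ ns)) = begin
  suc (suc (length (encode (node (c ∷ cs)) ++ D ∷ encode d)))
    ≡⟨ cong (suc ∘ suc) (length-++ (encode (node (c ∷ cs)))) ⟩
  suc (suc (length (encode (node (c ∷ cs)))) + suc (length (encode d)))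
    ≡⟨ cong₂ (λ x y → suc (x + y)) (length-encode (node f ns)) (length-encode n) ⟩
  suc ((suc (edges c) + edgesF cs) + edges d)
    ≡⟨ rearrange (edges c) (edgesF cs) (edges d) ⟩
  suc (edges c) + (suc (edges d) + edgesF cs) ∎
  where
  open ≡-Reasoning
  rearrange : ∀ a b e → suc ((suc a + b) + e) ≡ suc a + (suc e + b)
  rearrange = solve-∀

validFrom-U : ∀ h s → validFrom h (U ∷ s) ≡ validFrom (suc h) s
validFrom-U zero s = refl
validFrom-U (suc h) s = refl

validFrom-F : ∀ h s → validFrom h (F ∷ s) ≡ validFrom h s
validFrom-F zero s = refl
validFrom-F (suc h) s = refl

validFrom-encode-++ : ∀ {t} → NoYoung t → ∀ h r → validFrom h (encode t ++ r) ≡ validFrom h r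
validFrom-encode-++ (node leaf []) h r = refl
validFrom-encode-++ (node (tree n@(node _ _)) []) h r = trans (validFrom-F h _) (validFrom-encode-++ n h r)
validFrom-encode-++ (node {c} {d ∷ cs} f (n ∷ ns)) h r = begin
  validFrom h (U ∷ ((encode (node (c ∷ cs)) ++ D ∷ encode d) ++ r))
    ≡⟨ validFrom-U h _ ⟩
  validFrom (suc h) ((encode (node (c ∷ cs)) ++ D ∷ encode d) ++ r)
    ≡⟨ cong (validFrom (suc h)) (++-assoc (encode (node (c ∷ cs))) (D ∷ encode d) r) ⟩
  validFrom (suc h) (encode (node (c ∷ cs)) ++ D ∷ encode d ++ r)
    ≡⟨ validFrom-encode-++ (node f ns) (suc h) _ ⟩
  validFrom h (encode d ++ r)
    ≡⟨ validFrom-encode-++ n h r ⟩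
  validFrom h r ∎
  where open ≡-Reasoning

-- On a path from height h, decode leaves a stack of h + 1 trees (Stack h),
-- which encodeStack re-encodes separated by D steps. The last clause of push
-- is junk, never reached on such stacks.
push : Step → List PTree → List PTree
push U (node (c ∷ cs) ∷ d ∷ ts) = node (c ∷ d ∷ cs) ∷ ts
push D ts = stick ∷ ts
push F (t ∷ ts) = node (t ∷ []) ∷ ts
push _ ts = ts

decode : List Step → List PTree
decode = foldr push (stick ∷ [])

encodeStack : List PTree → List Step
encodeStack [] = []
encodeStack (t ∷ []) = encode t
encodeStack (t ∷ u ∷ us) = encode t ++ D ∷ encodeStack (u ∷ us)

data Stack : ℕ → List PTree → Set where
  [_] : ∀ {t} → NoYoung t → Stack zero (t ∷ [])
  _∷_ : ∀ {h t ts} → NoYoung t → Stack h ts → Stack (suc h) (t ∷ ts)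

NoYoung-stick : NoYoung stick
NoYoung-stick = node leaf []

Stack-push-U : ∀ {h ts} → Stack (suc h) ts → Stack h (push U ts)
Stack-push-U (node f ns ∷ [ n ]) = [ node f (n ∷ ns) ]
Stack-push-U (node f ns ∷ (n ∷ st)) = node f (n ∷ ns) ∷ st

Stack-push-F : ∀ {h ts} → Stack h ts → Stack h (push F ts)
Stack-push-F [ n ] = [ node (tree n) [] ]
Stack-push-F (n ∷ st) = node (tree n) [] ∷ st

Stack-decode : ∀ h s → validFrom h s ≡ true → Stack h (decode s)
Stack-decode zero [] _ = [ NoYoung-stick ]
Stack-decode h (U ∷ s) v = Stack-push-U (Stack-decode (suc h) s (trans (sym (validFrom-U h s)) v))
Stack-decode (suc h) (D ∷ s) v = NoYoung-stick ∷ Stack-decode h s v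
Stack-decode h (F ∷ s) v = Stack-push-F (Stack-decode h s (trans (sym (validFrom-F h s)) v))

encodeStack-push-U : ∀ {h ts} → Stack (suc h) ts → encodeStack (push U ts) ≡ U ∷ encodeStack ts
encodeStack-push-U (node _ _ ∷ [ _ ]) = refl
encodeStack-push-U (node {c} {cs} _ _ ∷ (_∷_ {t = d} _ [ _ ])) =
  cong (U ∷_) (++-assoc (encode (node (c ∷ cs))) (D ∷ encode d) _)
encodeStack-push-U (node {c} {cs} _ _ ∷ (_∷_ {t = d} _ (_ ∷ _))) =
  cong (U ∷_) (++-assoc (encode (node (c ∷ cs))) (D ∷ encode d) _)

encodeStack-push-D : ∀ {h ts} → Stack h ts → encodeStack (push D ts) ≡ D ∷ encodeStack ts
encodeStack-push-D [ _ ] = refl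
encodeStack-push-D (_ ∷ _) = refl

encodeStack-push-F : ∀ {h ts} → Stack h ts → encodeStack (push F ts) ≡ F ∷ encodeStack ts
encodeStack-push-F [ node _ _ ] = refl
encodeStack-push-F (node _ _ ∷ [ _ ]) = refl
encodeStack-push-F (node _ _ ∷ (_ ∷ _)) = refl

encodeStack-decode : ∀ h s → validFrom h s ≡ true → encodeStack (decode s) ≡ s
encodeStack-decode zero [] _ = refl
encodeStack-decode h (U ∷ s) v =
  trans (encodeStack-push-U (Stack-decode (suc h) s v′)) (cong (U ∷_) (encodeStack-decode (suc h) s v′))
  where v′ = trans (sym (validFrom-U h s)) v
encodeStack-decode (suc h) (D ∷ s) v =
  trans (encodeStack-push-D (Stack-decode h s v)) (cong (D ∷_) (encodeStack-decode h s v))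
encodeStack-decode h (F ∷ s) v =
  trans (encodeStack-push-F (Stack-decode h s v′)) (cong (F ∷_) (encodeStack-decode h s v′))
  where v′ = trans (sym (validFrom-F h s)) v

decode-encode-++ : ∀ {t} → NoYoung t → ∀ r ts → decode r ≡ stick ∷ ts → decode (encode t ++ r) ≡ t ∷ ts
decode-encode-++ (node leaf []) r ts eq = eq
decode-encode-++ (node (tree n@(node _ _)) []) r ts eq = cong (push F) (decode-encode-++ n r ts eq)
decode-encode-++ (node {c} {d ∷ cs} f (n ∷ ns)) r ts eq = begin
  push U (decode ((encode (node (c ∷ cs)) ++ D ∷ encode d) ++ r))
    ≡⟨ cong (push U ∘ decode) (++-assoc (encode (node (c ∷ cs))) (D ∷ encode d) r) ⟩
  push U (decode (encode (node (c ∷ cs)) ++ D ∷ encode d ++ r))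
    ≡⟨ cong (push U) (decode-encode-++ (node f ns) _ (d ∷ ts) (cong (push D) (decode-encode-++ n r ts eq))) ⟩
  node (c ∷ d ∷ cs) ∷ ts ∎
  where open ≡-Reasoning

decodeTree : List Step → PTree
decodeTree s with decode s
... | t ∷ _ = t
... | [] = stick

decode-MotzkinPath : ∀ s → isMotzkinPath s ≡ true → (decode s ≡ decodeTree s ∷ []) × NoYoung (decodeTree s)
decode-MotzkinPath s v with decode s | Stack-decode zero s v
... | _ | [ n ] = refl , n

encode-decodeTree : ∀ s → isMotzkinPath s ≡ true → encode (decodeTree s) ≡ s
encode-decodeTree s v = trans (cong encodeStack (sym (proj₁ (decode-MotzkinPath s v)))) (encodeStack-decode zero s v)

decodeTree-encode : ∀ {t} → NoYoung t → decodeTree (encode t) ≡ t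
decodeTree-encode {t} n with decode (encode t) | trans (cong decode (sym (++-identityʳ (encode t)))) (decode-encode-++ n [] [] refl)
... | _ | refl = refl

NoYoung-edges : ∀ {m} t → edges t ≡ suc m → youngLeaves t ≡ 0 → NoYoung t
NoYoung-edges (node (c ∷ cs)) _ y = youngLeaves≡0⇒NoYoung c cs y

module _ {m : ℕ} where
  toPath : Trees (suc m) youngLeaves 0 → Paths isMotzkinPath m
  toPath (t , e , y) = encode t , suc-injective (trans (length-encode n) e) , valid
    where
    n = NoYoung-edges t e y
    valid : isMotzkinPath (encode t) ≡ true
    valid = trans (cong isMotzkinPath (sym (++-identityʳ (encode t)))) (validFrom-encode-++ n zero [])

  toTree : Paths isMotzkinPath m → Trees (suc m) youngLeaves 0
  toTree (s , l , v) = decodeTree s , edges-decodeTree , NoYoung⇒youngLeaves≡0 n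
    where
    n = proj₂ (decode-MotzkinPath s v)
    edges-decodeTree : edges (decodeTree s) ≡ suc m
    edges-decodeTree = trans (sym (length-encode n)) (cong suc (trans (cong length (encode-decodeTree s v)) l))

  motzkin↔noYoung : Paths isMotzkinPath m ↔ Trees (suc m) youngLeaves 0
  motzkin↔noYoung = mk↔ₛ′ toTree toPath
    (λ { (t , e , y) → Trees-≡ (decodeTree-encode (NoYoung-edges t e y)) })
    (λ { (s , l , v) → Paths-≡ (encode-decodeTree s v) })

mainTheorem3 : (m : ℕ) →
    (Fin (2 ^ m) ↔ Σ PTree (λ t → (edges t ≡ suc m) × (oldLeaves t ≡ 1)))
    × (Fin (Motzkin m) ↔ Σ PTree (λ t → (edges t ≡ suc m) × (youngLeaves t ≡ 0)))
mainTheorem3 m = oneOld↔ m , ↔-trans (countTrue-allSeqs↔ m isMotzkinPath) motzkin↔noYoung
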